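{- There exists a uniformly recurrent infinite word with bounded Abelian complexity that does not have a prefix that is an Abelian square.
   Context: For an infinite word $\mathbf{x}$, its Abelian complexity $\rho^{ab}_{\mathbf{x}}(n)$ is the number of Abelian equivalence classes among the factors of $\mathbf{x}$ of length $n$, where two finite words are Abelian equivalent if every letter occurs the same number of times in each. It is bounded if $\sup_n\rho^{ab}_{\mathbf{x}}(n)<\infty$. An Abelian square is a word $uv$ with $u,v$ nonempty and Abelian equivalent. An infinite word is uniformly recurrent if every factor occurs infinitely often and the gaps between consecutive occurrences of each factor are bounded. -}

module Defs where

open import Data.Nat using (ℕ; zero; suc; _+_; _≤_; _<_)
open import Data.Fin using (Fin)
open import Data.Fin.Properties using (_≟_)
open import Data.Product using (Σ; ∃; ∃-syntax; _×_; _,_)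
open import Relation.Binary.PropositionalEquality using (_≡_; _≢_)
open import Relation.Nullary using (¬_; yes; no)

Word : ℕ → Set
Word k = ℕ → Fin k

count : ∀ {k} → Word k → Fin k → ℕ → ℕ → ℕ
count x a i zero = 0
count x a i (suc n) with x i ≟ a
... | yes _ = suc (count x a (suc i) n)
... | no  _ = count x a (suc i) n

AbEq : ∀ {k} → Word k → ℕ → ℕ → ℕ → Set
AbEq x i j n = ∀ a → count x a i n ≡ count x a j n

-- ρ^ab_x(n) ≤ B : among any B+1 factors of length n, two are Abelian equivalent
AbComplexityAtMost : ∀ {k} → Word k → ℕ → ℕ → Set
AbComplexityAtMost x B n =
  (f : Fin (suc B) → ℕ) → ∃[ p ] ∃[ q ] (p ≢ q × AbEq x (f p) (f q) n)

BoundedAbelianComplexity : ∀ {k} → Word k → Set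
BoundedAbelianComplexity x = ∃[ B ] ∀ n → AbComplexityAtMost x B n

SameFactor : ∀ {k} → Word k → ℕ → ℕ → ℕ → Set
SameFactor x i j n = ∀ t → t < n → x (i + t) ≡ x (j + t)

UniformlyRecurrent : ∀ {k} → Word k → Set
UniformlyRecurrent x =
  ∀ i n → ∃[ g ] ∀ m → ∃[ j ] (m ≤ j × j ≤ m + g × SameFactor x i j n)

HasAbelianSquarePrefix : ∀ {k} → Word k → Set
HasAbelianSquarePrefix x = ∃[ m ] (1 ≤ m × AbEq x 0 m m)

-- The witness is y ∘ suc (y with its first letter removed), where
-- y = 012 102 102 012 … is the fixed point, starting with 0, of the
-- 3-uniform morphism  0 ↦ 012, 1 ↦ 102, 2 ↦ 102; that is,
-- y (d + 3q) = σ (y q) d for every base-3 digit d.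
--
-- For the
-- fixed point of any 3-uniform morphism with start letter a, the prefix of
-- length 3^K reappears at 3^K·t whenever y t = a, so y is uniformly recurrent
-- as soon as a occurs with bounded gaps.  For our σ every image is a
-- permutation of 012: aligned blocks of three letters contain each letter
-- once, so y is 3-balanced, and 0 occurs in every window of length 5.
-- Finally, counting 2s (for |u| ≢ 0 mod 3) and 0s (for 3 ∣ |u|) in prefixes
-- rules out an Abelian square prefix uu of y ∘ suc; the second case reduces
-- to the fact that y q and y (2q) are never both 0 when q ≥ 1.
module Submission where

open import Defs
open import Data.Nat using (ℕ; zero; suc; _+_; _*_; _∸_; _^_; _≤_; _<_; z≤n; s≤s; NonZero)
open import Data.Nat.Properties hiding (_≟_)
open import Data.Nat.DivMod using (_/_; _%_; m≡m%n+[m/n]*n; m%n<n; m/n*n≤m)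
open import Data.Nat.Induction using (<-rec)
open import Data.Nat.Tactic.RingSolver using (solve-∀)
open import Data.Fin using (Fin; toℕ; fromℕ<; funToFin; finToFun) renaming (suc to fsuc)
open import Data.Fin.Patterns using (0F; 1F; 2F)
open import Data.Fin.Properties using (_≟_; toℕ<n; toℕ-fromℕ<; finToFun-funToFin; pigeonhole)
  renaming (<⇒≢ to <⇒≢ᶠ)
open import Data.Product using (_×_; _,_; proj₁; proj₂; ∃-syntax)
open import Data.Empty using (⊥)
open import Function using (_∘_)
open import Relation.Binary.PropositionalEquality
open import Relation.Nullary using (¬_; yes; no)

occ : ∀ {k} → Fin k → Fin k → ℕ
occ b a with b ≟ a
... | yes _ = 1
... | no  _ = 0

module _ {k} (x : Word k) (a : Fin k) where

  count-suc : ∀ i n → count x a i (suc n) ≡ occ (x i) a + count x a (suc i) n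
  count-suc i n with x i ≟ a
  ... | yes _ = refl
  ... | no  _ = refl

  count-++ : ∀ i m n → count x a i (m + n) ≡ count x a i m + count x a (i + m) n
  count-++ i zero    n = cong (λ j → count x a j n) (sym (+-identityʳ i))
  count-++ i (suc m) n
    rewrite count-suc i (m + n) | count-suc i m | count-++ (suc i) m n | +-suc i m
    = sym (+-assoc (occ (x i) a) _ _)

  count-three : ∀ i → count x a i 3 ≡ occ (x i) a + (occ (x (1 + i)) a + occ (x (2 + i)) a)
  count-three i rewrite count-suc i 2 | count-suc (1 + i) 1 | count-suc (2 + i) 0 =
    cong (λ s → occ (x i) a + (occ (x (1 + i)) a + s)) (+-identityʳ _)

  count-⊆ : ∀ {i j m n} → i ≤ j → j + m ≤ i + n → count x a j m ≤ count x a i n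
  count-⊆ {i} {j} {m} {n} i≤j j+m≤i+n with m≤n⇒∃[o]m+o≡n i≤j
  ... | p , refl = begin
    count x a (i + p) m                  ≤⟨ m≤n+m _ _ ⟩
    count x a i p + count x a (i + p) m  ≡⟨ count-++ i p m ⟨
    count x a i (p + m)                  ≤⟨ count-extend p+m≤n ⟩
    count x a i n                        ∎
    where
    open ≤-Reasoning
    p+m≤n : p + m ≤ n
    p+m≤n = +-cancelˡ-≤ i _ _ (subst (_≤ i + n) (+-assoc i p m) j+m≤i+n)
    count-extend : ∀ {l l′} → l ≤ l′ → count x a i l ≤ count x a i l′
    count-extend {l} l≤l′ with m≤n⇒∃[o]m+o≡n l≤l′
    ... | o , refl = subst (_ ≤_) (sym (count-++ i l o)) (m≤m+n _ _)

count-drop : ∀ {k} (x : Word k) a i n → count (x ∘ suc) a i n ≡ count x a (suc i) n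
count-drop x a i zero = refl
count-drop x a i (suc n)
  rewrite count-suc (x ∘ suc) a i n | count-suc x a (suc i) n | count-drop x a (suc i) n = refl

Balanced : ∀ {k} → ℕ → Word k → Set
Balanced c x = ∀ a i j n → count x a i n ≤ count x a j n + c

-- The Parikh vector of a factor is determined by its offsets from the Parikh
-- vector of the prefix, each in [0, 2c]; pigeonhole on the (2c+1)^k offset
-- vectors gives two Abelian equivalent factors among any (2c+1)^k + 1.
balanced⇒bounded : ∀ {k} c (x : Word k) → Balanced c x → BoundedAbelianComplexity x
balanced⇒bounded {k} c x balanced = suc (c + c) ^ k , at-most
  where
  offset-bound : ∀ n i a → count x a i n + c ∸ count x a 0 n ≤ c + c
  offset-bound n i a = m≤n+o⇒m∸n≤o (count x a i n + c) (count x a 0 n) (begin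
    count x a i n + c        ≤⟨ +-monoˡ-≤ c (balanced a i 0 n) ⟩
    count x a 0 n + c + c    ≡⟨ +-assoc _ c c ⟩
    count x a 0 n + (c + c)  ∎)
    where open ≤-Reasoning

  offset : ℕ → ℕ → Fin k → Fin (suc (c + c))
  offset n i a = fromℕ< (s≤s (offset-bound n i a))

  same-offsets : ∀ n i j → funToFin (offset n i) ≡ funToFin (offset n j) → AbEq x i j n
  same-offsets n i j eq a =
    +-cancelʳ-≡ c _ _ (∸-cancelʳ-≡ (balanced a 0 i n) (balanced a 0 j n) (begin
      count x a i n + c ∸ count x a 0 n  ≡⟨ toℕ-fromℕ< _ ⟨
      toℕ (offset n i a)                 ≡⟨ cong toℕ same-letter-offset ⟩
      toℕ (offset n j a)                 ≡⟨ toℕ-fromℕ< _ ⟩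
      count x a j n + c ∸ count x a 0 n  ∎))
    where
    open ≡-Reasoning
    same-letter-offset : offset n i a ≡ offset n j a
    same-letter-offset = trans (sym (finToFun-funToFin (offset n i) a))
      (trans (cong (λ v → finToFun v a) eq) (finToFun-funToFin (offset n j) a))

  at-most : ∀ n → AbComplexityAtMost x (suc (c + c) ^ k) n
  at-most n f with pigeonhole (n<1+n _) (λ p → funToFin (offset n (f p)))
  ... | p , q , p<q , eq = p , q , <⇒≢ᶠ p<q , same-offsets n (f p) (f q) eq

balanced-drop : ∀ {k} c (x : Word k) → Balanced c x → Balanced c (x ∘ suc)
balanced-drop c x balanced a i j n
  rewrite count-drop x a i n | count-drop x a j n = balanced a (suc i) (suc j) n

uniformlyRecurrent-drop : ∀ {k} (x : Word k) → UniformlyRecurrent x → UniformlyRecurrent (x ∘ suc)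
uniformlyRecurrent-drop x recurrent i n with recurrent (suc i) n
... | g , occurs = g , shifted
  where
  shifted : ∀ m → ∃[ j ] (m ≤ j × j ≤ m + g × SameFactor (x ∘ suc) i j n)
  shifted m with occurs (suc m)
  ... | suc j , s≤s m≤j , s≤s j≤m+g , same = j , m≤j , j≤m+g , same

-- An Abelian square prefix uu of x ∘ suc doubles the letter counts of u; in
-- terms of prefixes of x (which start with the extra letter x 0):
square-prefix-counts : ∀ {k} (x : Word k) m → AbEq (x ∘ suc) 0 m m →
  ∀ a → count x a 0 (suc (m + m)) + occ (x 0) a ≡ count x a 0 (suc m) + count x a 0 (suc m)
square-prefix-counts x m square a = begin
  count x a 0 (suc (m + m)) + o  ≡⟨ cong (_+ o) (prefix-suc (m + m)) ⟩
  o + X (m + m) + o              ≡⟨ cong (λ s → o + s + o) doubled ⟩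
  o + (X m + X m) + o            ≡⟨ regroup o (X m) ⟩
  (o + X m) + (o + X m)          ≡⟨ cong₂ _+_ (prefix-suc m) (prefix-suc m) ⟨
  count x a 0 (suc m) + count x a 0 (suc m) ∎
  where
  open ≡-Reasoning
  o = occ (x 0) a
  X = count (x ∘ suc) a 0
  prefix-suc : ∀ n → count x a 0 (suc n) ≡ o + X n
  prefix-suc n = trans (count-suc x a 0 n) (cong (o +_) (sym (count-drop x a 0 n)))
  doubled : X (m + m) ≡ X m + X m
  doubled = trans (count-++ (x ∘ suc) a 0 m m) (cong (X m +_) (sym (square a)))
  regroup : ∀ o c → o + (c + c) + o ≡ (o + c) + (o + c)
  regroup = solve-∀

divMod3 : ℕ → ℕ × Fin 3
divMod3 zero = 0 , 0F
divMod3 (suc n) with divMod3 n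
... | q , 0F = q , 1F
... | q , 1F = q , 2F
... | q , 2F = suc q , 0F

quot3 : ℕ → ℕ
quot3 = proj₁ ∘ divMod3

digit3 : ℕ → Fin 3
digit3 = proj₂ ∘ divMod3

divMod3-correct : ∀ n → toℕ (digit3 n) + 3 * quot3 n ≡ n
divMod3-correct zero = refl
divMod3-correct (suc n) with divMod3 n | divMod3-correct n
... | q , 0F | e = cong suc e
... | q , 1F | e = cong suc e
... | q , 2F | e = trans (*-suc 3 q) (cong suc e)

divMod3-unique : ∀ q d → divMod3 (toℕ d + 3 * q) ≡ (q , d)
divMod3-unique q 0F = multiple q
  where
  multiple : ∀ q → divMod3 (3 * q) ≡ (q , 0F)
  multiple zero = refl
  multiple (suc q) = trans (cong divMod3 (*-suc 3 q)) (next-block {3 * q} (multiple q))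
    where
    next-block : ∀ {n q} → divMod3 n ≡ (q , 0F) → divMod3 (3 + n) ≡ (suc q , 0F)
    next-block eq rewrite eq = refl
divMod3-unique q 1F rewrite divMod3-unique q 0F = refl
divMod3-unique q 2F rewrite divMod3-unique q 0F = refl

data Base3 : ℕ → Set where
  base3 : ∀ q (d : Fin 3) → Base3 (toℕ d + 3 * q)

base3? : ∀ n → Base3 n
base3? n = subst Base3 (divMod3-correct n) (base3 (quot3 n) (digit3 n))

digit≤ : ∀ (d : Fin 3) → toℕ d ≤ 3
digit≤ d = <⇒≤ (toℕ<n d)

digit+3*≤ : ∀ (d : Fin 3) t → toℕ d + 3 * t ≤ 3 * suc t
digit+3*≤ d t = subst (toℕ d + 3 * t ≤_) (sym (*-suc 3 t)) (+-monoˡ-≤ (3 * t) (digit≤ d))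

-- The quotient strictly decreases; this makes the approximations below stabilise.
quot3< : ∀ n → 1 ≤ n → quot3 n < n
quot3< n 1≤n with base3? n
... | base3 q d rewrite divMod3-unique q d with q
...   | zero  = 1≤n
...   | suc p = ≤-trans (m<m*n (suc p) 3 (s≤s (s≤s z≤n)))
                  (≤-trans (≤-reflexive (*-comm (suc p) 3)) (m≤n+m _ (toℕ d)))

-- Any factor x[i, i+n) lies inside the prefix of length 3^(i+n).
n<3^n : ∀ n → n < 3 ^ n
n<3^n zero = s≤s z≤n
n<3^n (suc n) = begin-strict
  suc n            <⟨ s≤s (n<3^n n) ⟩
  1 + 3 ^ n        ≤⟨ +-monoˡ-≤ (3 ^ n) (m^n>0 3 n) ⟩
  3 ^ n + 3 ^ n    ≤⟨ +-monoʳ-≤ (3 ^ n) (m≤m+n (3 ^ n) _) ⟩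
  3 ^ suc n        ∎
  where open ≤-Reasoning

multiple-near : ∀ P .{{_ : NonZero P}} m → ∃[ u ] (m ≤ P * u × P * u ≤ m + P)
multiple-near P m = suc (m / P) , lower , upper
  where
  open ≤-Reasoning
  lower : m ≤ P * suc (m / P)
  lower = begin
    m                  ≡⟨ m≡m%n+[m/n]*n m P ⟩
    m % P + m / P * P  ≤⟨ +-monoˡ-≤ (m / P * P) (<⇒≤ (m%n<n m P)) ⟩
    P + m / P * P      ≡⟨ cong (P +_) (*-comm (m / P) P) ⟩
    P + P * (m / P)    ≡⟨ *-suc P (m / P) ⟨
    P * suc (m / P)    ∎
  upper : P * suc (m / P) ≤ m + P
  upper = begin
    P * suc (m / P)    ≡⟨ *-suc P (m / P) ⟩
    P + P * (m / P)    ≡⟨ cong (P +_) (*-comm P (m / P)) ⟩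
    P + m / P * P      ≤⟨ +-monoʳ-≤ P (m/n*n≤m m P) ⟩
    P + m              ≡⟨ +-comm P m ⟩
    m + P              ∎

module UniformFixedPoint {k} (σ : Fin k → Fin 3 → Fin k) (a : Fin k) (σa0≡a : σ a 0F ≡ a) where

  -- approx f n is the letter at n of σ^f(a); it stabilises once n < f.
  approx : ℕ → Word k
  approx zero    _ = a
  approx (suc f) n = σ (approx f (quot3 n)) (digit3 n)

  approx-at-0 : ∀ f → approx f 0 ≡ a
  approx-at-0 zero = refl
  approx-at-0 (suc f) rewrite approx-at-0 f = σa0≡a

  approx-stable : ∀ f g n → n < f → n < g → approx f n ≡ approx g n
  approx-stable (suc f) (suc g) zero _ _ = trans (approx-at-0 (suc f)) (sym (approx-at-0 (suc g)))
  approx-stable (suc f) (suc g) (suc n) (s≤s n<f) (s≤s n<g) =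
    cong (λ b → σ b (digit3 (suc n)))
      (approx-stable f g (quot3 (suc n)) (<-≤-trans q<n n<f) (<-≤-trans q<n n<g))
    where q<n = quot3< (suc n) (s≤s z≤n)

  fix : Word k
  fix n = approx (suc n) n

  fix-unfold : ∀ q d → fix (toℕ d + 3 * q) ≡ σ (fix q) d
  fix-unfold q d = begin
    approx (suc N) N                        ≡⟨ approx-stable (suc N) (suc (suc N)) N (n<1+n N) (m<n⇒m<1+n (n<1+n N)) ⟩
    σ (approx (suc N) (quot3 N)) (digit3 N) ≡⟨ cong (λ p → σ (approx (suc N) (proj₁ p)) (proj₂ p)) (divMod3-unique q d) ⟩
    σ (approx (suc N) q) d                  ≡⟨ cong (λ b → σ b d) (approx-stable (suc N) (suc q) q (s≤s q≤N) (n<1+n q)) ⟩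
    σ (fix q) d                             ∎
    where
    open ≡-Reasoning
    N = toℕ d + 3 * q
    q≤N : q ≤ N
    q≤N = ≤-trans (m≤n*m q 3) (m≤n+m (3 * q) (toℕ d))

  fix-self-similar : ∀ K t r → fix t ≡ a → r < 3 ^ K → fix (3 ^ K * t + r) ≡ fix r
  fix-self-similar zero t zero fix-t≡a _ =
    trans (cong fix (trans (+-identityʳ _) (*-identityˡ t))) (trans fix-t≡a (sym (approx-at-0 1)))
  fix-self-similar zero t (suc r) _ (s≤s ())
  fix-self-similar (suc K) t r fix-t≡a r< with base3? r
  ... | base3 q d = begin
    fix (3 ^ suc K * t + (toℕ d + 3 * q))  ≡⟨ cong fix (regroup (3 ^ K) t (toℕ d) q) ⟩
    fix (toℕ d + 3 * (3 ^ K * t + q))      ≡⟨ fix-unfold (3 ^ K * t + q) d ⟩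
    σ (fix (3 ^ K * t + q)) d              ≡⟨ cong (λ b → σ b d) (fix-self-similar K t q fix-t≡a q<) ⟩
    σ (fix q) d                            ≡⟨ fix-unfold q d ⟨
    fix (toℕ d + 3 * q)                    ∎
    where
    open ≡-Reasoning
    regroup : ∀ P t d q → 3 * P * t + (d + 3 * q) ≡ d + 3 * (P * t + q)
    regroup = solve-∀
    q< : q < 3 ^ K
    q< = *-cancelˡ-< 3 q (3 ^ K) (≤-<-trans (m≤n+m (3 * q) (toℕ d)) r<)

  -- If a occurs in every window of length g + 1, then fix is uniformly recurrent:
  -- a factor at i of length n occurs at 3^(i+n)·t + i for every t with fix t = a.
  fix-uniformlyRecurrent : ∀ g → (∀ m → ∃[ t ] (m ≤ t × t ≤ m + g × fix t ≡ a)) →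
                           UniformlyRecurrent fix
  fix-uniformlyRecurrent g a-near i n = P * suc g + i , occurrence
    where
    P = 3 ^ (i + n)
    instance
      P≢0 : NonZero P
      P≢0 = m^n≢0 3 (i + n)

    occurrence : ∀ m → ∃[ j ] (m ≤ j × j ≤ m + (P * suc g + i) × SameFactor fix i j n)
    occurrence m with multiple-near P m
    ... | u , m≤Pu , Pu≤m+P with a-near u
    ... | t , u≤t , t≤u+g , fix-t≡a = P * t + i , start , end , same
      where
      start : m ≤ P * t + i
      start = ≤-trans m≤Pu (≤-trans (*-monoʳ-≤ P u≤t) (m≤m+n (P * t) i))
      regroup : ∀ m P g i → m + P + P * g + i ≡ m + (P * suc g + i)
      regroup = solve-∀
      end : P * t + i ≤ m + (P * suc g + i)
      end = begin
        P * t + i          ≤⟨ +-monoˡ-≤ i (*-monoʳ-≤ P t≤u+g) ⟩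
        P * (u + g) + i    ≡⟨ cong (_+ i) (*-distribˡ-+ P u g) ⟩
        P * u + P * g + i  ≤⟨ +-monoˡ-≤ i (+-monoˡ-≤ (P * g) Pu≤m+P) ⟩
        m + P + P * g + i  ≡⟨ regroup m P g i ⟩
        m + (P * suc g + i) ∎
        where open ≤-Reasoning
      same : SameFactor fix i (P * t + i) n
      same s s<n = sym (trans (cong fix (+-assoc (P * t) i s))
        (fix-self-similar (i + n) t (i + s) fix-t≡a (<-trans (+-monoʳ-< i s<n) (n<3^n (i + n)))))

-- The morphism 0 ↦ 012, 1 ↦ 102, 2 ↦ 102, as σ b d = d-th letter of the image of b;
-- y is its fixed point starting with 0.
σ : Fin 3 → Fin 3 → Fin 3
σ 0F d = d
σ (fsuc _) 0F = 1F
σ (fsuc _) 1F = 0F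
σ (fsuc _) 2F = 2F

open UniformFixedPoint σ 0F refl using (fix-unfold; fix-uniformlyRecurrent) renaming (fix to y)

σ-permutation : ∀ b a → occ (σ b 0F) a + (occ (σ b 1F) a + occ (σ b 2F) a) ≡ 1
σ-permutation 0F       0F = refl
σ-permutation 0F       1F = refl
σ-permutation 0F       2F = refl
σ-permutation (fsuc _) 0F = refl
σ-permutation (fsuc _) 1F = refl
σ-permutation (fsuc _) 2F = refl

σ-zero : ∀ b → ∃[ e ] (toℕ e ≤ 1 × σ b e ≡ 0F)
σ-zero 0F       = 0F , z≤n , refl
σ-zero (fsuc _) = 1F , s≤s z≤n , refl

σ-zero⁻¹ : ∀ b → σ b 0F ≡ 0F → b ≡ 0F
σ-zero⁻¹ 0F _ = refl

σ-occ-0 : ∀ b → occ (σ b 0F) 0F ≡ occ b 0F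
σ-occ-0 0F       = refl
σ-occ-0 (fsuc _) = refl

σ-2F : ∀ b → σ b 2F ≡ 2F
σ-2F 0F       = refl
σ-2F (fsuc _) = refl

σ-no-early-2 : ∀ b → occ (σ b 0F) 2F ≡ 0 × occ (σ b 1F) 2F ≡ 0
σ-no-early-2 0F       = refl , refl
σ-no-early-2 (fsuc _) = refl , refl

aligned-block : ∀ t a → count y a (3 * t) 3 ≡ 1
aligned-block t a
  rewrite count-three y a (3 * t) | fix-unfold t 0F | fix-unfold t 1F | fix-unfold t 2F
  = σ-permutation (y t) a

aligned-count : ∀ t q a → count y a (3 * t) (3 * q) ≡ q
aligned-count t zero a = refl
aligned-count t (suc q) a = begin
  count y a (3 * t) (3 * suc q)                      ≡⟨ cong (count y a (3 * t)) (*-suc 3 q) ⟩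
  count y a (3 * t) (3 + 3 * q)                      ≡⟨ count-++ y a (3 * t) 3 (3 * q) ⟩
  count y a (3 * t) 3 + count y a (3 * t + 3) (3 * q) ≡⟨ cong₂ _+_ (aligned-block t a) (cong (λ j → count y a j (3 * q)) next-block) ⟩
  1 + count y a (3 * suc t) (3 * q)                  ≡⟨ cong suc (aligned-count (suc t) q a) ⟩
  suc q                                              ∎
  where
  open ≡-Reasoning
  next-block : 3 * t + 3 ≡ 3 * suc t
  next-block = trans (+-comm (3 * t) 3) (sym (*-suc 3 t))

-- A factor of length r + 3(q+1) contains q aligned blocks; one of length
-- r + 3q lies inside q + 2 aligned blocks.
count-lower : ∀ a i q (r : Fin 3) → q ≤ count y a i (toℕ r + 3 * suc q)
count-lower a i q r with base3? i
... | base3 t d = begin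
  q                                              ≡⟨ aligned-count (suc t) q a ⟨
  count y a (3 * suc t) (3 * q)                  ≤⟨ count-⊆ y a (digit+3*≤ d t) inside ⟩
  count y a (toℕ d + 3 * t) (toℕ r + 3 * suc q)  ∎
  where
  open ≤-Reasoning
  regroup : ∀ t q → 3 * suc t + 3 * q ≡ 3 * t + 3 * suc q
  regroup = solve-∀
  inside : 3 * suc t + 3 * q ≤ toℕ d + 3 * t + (toℕ r + 3 * suc q)
  inside = subst (_≤ toℕ d + 3 * t + (toℕ r + 3 * suc q)) (sym (regroup t q))
    (+-mono-≤ (m≤n+m (3 * t) (toℕ d)) (m≤n+m (3 * suc q) (toℕ r)))

count-upper : ∀ a i q (r : Fin 3) → count y a i (toℕ r + 3 * q) ≤ q + 2
count-upper a i q r with base3? i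
... | base3 t d = begin
  count y a (toℕ d + 3 * t) (toℕ r + 3 * q)  ≤⟨ count-⊆ y a (m≤n+m (3 * t) (toℕ d)) inside ⟩
  count y a (3 * t) (3 * (q + 2))            ≡⟨ aligned-count t (q + 2) a ⟩
  q + 2                                      ∎
  where
  open ≤-Reasoning
  regroup : ∀ d t r q → d + 3 * t + (r + 3 * q) ≡ 3 * t + 3 * q + (d + r)
  regroup = solve-∀
  regroup′ : ∀ t q → 3 * t + 3 * q + 6 ≡ 3 * t + 3 * (q + 2)
  regroup′ = solve-∀
  inside : toℕ d + 3 * t + (toℕ r + 3 * q) ≤ 3 * t + 3 * (q + 2)
  inside = subst₂ _≤_ (sym (regroup (toℕ d) t (toℕ r) q)) (regroup′ t q)
    (+-monoʳ-≤ (3 * t + 3 * q) (+-mono-≤ (digit≤ d) (digit≤ r)))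

-- By the two bounds, counts in factors of length r + 3q lie in [q - 1, q + 2].
y-balanced : Balanced 3 y
y-balanced a i j n with base3? n
... | base3 zero r = ≤-trans (count-upper a i 0 r) (≤-trans (n≤1+n 2) (m≤n+m 3 _))
... | base3 (suc q) r = begin
  count y a i (toℕ r + 3 * suc q)      ≤⟨ count-upper a i (suc q) r ⟩
  suc q + 2                            ≡⟨ +-suc q 2 ⟨
  q + 3                                ≤⟨ +-monoˡ-≤ 3 (count-lower a j q r) ⟩
  count y a j (toℕ r + 3 * suc q) + 3  ∎
  where open ≤-Reasoning

-- 0 occurs in every window [m, m + 4] of y: in the block after the one of m.
zero-near : ∀ m → ∃[ t ] (m ≤ t × t ≤ m + 4 × y t ≡ 0F)
zero-near m with base3? m
... | base3 v d with σ-zero (y (suc v))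
...   | e , e≤1 , σe≡0 = toℕ e + 3 * suc v , start , end , trans (fix-unfold (suc v) e) σe≡0
  where
  start : toℕ d + 3 * v ≤ toℕ e + 3 * suc v
  start = ≤-trans (digit+3*≤ d v) (m≤n+m (3 * suc v) (toℕ e))
  regroup : ∀ v → 1 + 3 * suc v ≡ 3 * v + 4
  regroup = solve-∀
  end : toℕ e + 3 * suc v ≤ toℕ d + 3 * v + 4
  end = ≤-trans (+-monoˡ-≤ (3 * suc v) e≤1)
          (subst (_≤ toℕ d + 3 * v + 4) (sym (regroup v)) (+-monoˡ-≤ 4 (m≤n+m (3 * v) (toℕ d))))

2F≢0F : _≢_ {A = Fin 3} 2F 0F
2F≢0F ()

y-digit2 : ∀ t → y (2 + 3 * t) ≡ 2F
y-digit2 t = trans (fix-unfold t 2F) (σ-2F (y t))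

y-triple-zero : ∀ t → y (3 * t) ≡ 0F → y t ≡ 0F
y-triple-zero t y3t≡0 = σ-zero⁻¹ (y t) (trans (sym (fix-unfold t 0F)) y3t≡0)

-- For q ≥ 1 the letters y q and y (2q) are not both 0, by strong induction:
-- a 0 only occurs at digits 0 and 1, so q = 3t, and then y t = y (2t) = 0.
no-zero-pair : ∀ q → 1 ≤ q → y q ≡ 0F → y (q + q) ≡ 0F → ⊥
no-zero-pair = <-rec _ step
  where
  double-digit1 : ∀ t → suc (3 * t) + suc (3 * t) ≡ 2 + 3 * (t + t)
  double-digit1 = solve-∀
  step : ∀ q → (∀ {t} → t < q → 1 ≤ t → y t ≡ 0F → y (t + t) ≡ 0F → ⊥) →
         1 ≤ q → y q ≡ 0F → y (q + q) ≡ 0F → ⊥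
  step q smaller with base3? q
  ... | base3 zero 0F = λ ()
  ... | base3 (suc t) 0F = λ _ yq≡0 y2q≡0 →
    smaller (≤-trans (m<m*n (suc t) 3 (s≤s (s≤s z≤n))) (≤-reflexive (*-comm (suc t) 3))) (s≤s z≤n)
      (y-triple-zero (suc t) yq≡0)
      (y-triple-zero (suc t + suc t) (trans (cong y (*-distribˡ-+ 3 (suc t) (suc t))) y2q≡0))
  ... | base3 t 1F = λ _ _ y2q≡0 →
    2F≢0F (trans (sym (y-digit2 (t + t))) (trans (cong y (sym (double-digit1 t))) y2q≡0))
  ... | base3 t 2F = λ _ yq≡0 _ → 2F≢0F (trans (sym (y-digit2 t)) yq≡0)

prefix-count : ∀ a q (d : Fin 3) → count y a 0 (toℕ d + 3 * q) ≡ q + count y a (3 * q) (toℕ d)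
prefix-count a q d = begin
  count y a 0 (toℕ d + 3 * q)                      ≡⟨ cong (count y a 0) (+-comm (toℕ d) (3 * q)) ⟩
  count y a 0 (3 * q + toℕ d)                      ≡⟨ count-++ y a 0 (3 * q) (toℕ d) ⟩
  count y a 0 (3 * q) + count y a (3 * q) (toℕ d)  ≡⟨ cong (_+ count y a (3 * q) (toℕ d)) (aligned-count 0 q a) ⟩
  q + count y a (3 * q) (toℕ d)                    ∎
  where open ≡-Reasoning

prefix-count-2 : ∀ q (d : Fin 3) → count y 2F 0 (toℕ d + 3 * q) ≡ q
prefix-count-2 q d = trans (prefix-count 2F q d) (trans (cong (q +_) (partial-block d)) (+-identityʳ q))
  where
  partial-block : ∀ (d : Fin 3) → count y 2F (3 * q) (toℕ d) ≡ 0
  partial-block 0F = refl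
  partial-block 1F rewrite count-suc y 2F (3 * q) 0 | fix-unfold q 0F | proj₁ (σ-no-early-2 (y q)) = refl
  partial-block 2F
    rewrite count-suc y 2F (3 * q) 1 | count-suc y 2F (suc (3 * q)) 0
          | fix-unfold q 0F | fix-unfold q 1F
          | proj₁ (σ-no-early-2 (y q)) | proj₂ (σ-no-early-2 (y q)) = refl

prefix-count-0 : ∀ q → count y 0F 0 (suc (3 * q)) ≡ q + occ (y q) 0F
prefix-count-0 q rewrite prefix-count 0F q 1F | count-suc y 0F (3 * q) 0 | fix-unfold q 0F
  = cong (q +_) (trans (+-identityʳ _) (σ-occ-0 (y q)))

odd≢even : ∀ m n → suc (m + m) ≢ n + n
odd≢even zero    zero    ()
odd≢even zero    (suc n) eq rewrite +-suc n n with eq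
... | ()
odd≢even (suc m) zero    ()
odd≢even (suc m) (suc n) eq rewrite +-suc m m | +-suc n n =
  odd≢even m n (suc-injective (suc-injective eq))

both-zero : ∀ (b c : Fin 3) → occ c 0F + 1 ≡ occ b 0F + occ b 0F → b ≡ 0F × c ≡ 0F
both-zero 0F       0F       _  = refl , refl
both-zero 0F       (fsuc _) ()
both-zero (fsuc _) 0F       ()
both-zero (fsuc _) (fsuc _) ()

-- Half-length 3q with q ≥ 1: the prefixes of y of lengths 1 + 6q and 1 + 3q
-- contain 2q + [y (2q) = 0] and q + [y q = 0] zeros, so both indicators are 1.
no-square-digit0 : ∀ q → 1 ≤ q → ¬ AbEq (y ∘ suc) 0 (3 * q) (3 * q)
no-square-digit0 q 1≤q square = no-zero-pair q 1≤q (proj₁ zeros) (proj₂ zeros)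
  where
  cancel : ∀ q o₁ o₂ → q + q + o₂ + 1 ≡ (q + o₁) + (q + o₁) → o₂ + 1 ≡ o₁ + o₁
  cancel q o₁ o₂ eq = +-cancelˡ-≡ (q + q) _ _ (trans (sym (lhs q o₂)) (trans eq (rhs q o₁)))
    where
    lhs : ∀ q o → q + q + o + 1 ≡ q + q + (o + 1)
    lhs = solve-∀
    rhs : ∀ q o → (q + o) + (q + o) ≡ q + q + (o + o)
    rhs = solve-∀
  zeros : y q ≡ 0F × y (q + q) ≡ 0F
  zeros = both-zero (y q) (y (q + q)) (cancel q (occ (y q) 0F) (occ (y (q + q)) 0F) (begin
    q + q + occ (y (q + q)) 0F + 1                           ≡⟨ cong (_+ 1) (prefix-count-0 (q + q)) ⟨
    count y 0F 0 (suc (3 * (q + q))) + 1                     ≡⟨ cong (λ n → count y 0F 0 (suc n) + 1) (*-distribˡ-+ 3 q q) ⟩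
    count y 0F 0 (suc (3 * q + 3 * q)) + 1                   ≡⟨ square-prefix-counts y (3 * q) square 0F ⟩
    count y 0F 0 (suc (3 * q)) + count y 0F 0 (suc (3 * q))  ≡⟨ cong₂ _+_ (prefix-count-0 q) (prefix-count-0 q) ⟩
    (q + occ (y q) 0F) + (q + occ (y q) 0F)                  ∎))
    where open ≡-Reasoning

-- Half-length 1 + 3q: the prefixes of y of lengths 3 + 6q and 2 + 3q contain
-- 2q + 1 and q letters 2, and 2q + 1 ≠ 2q.
no-square-digit1 : ∀ q → ¬ AbEq (y ∘ suc) 0 (1 + 3 * q) (1 + 3 * q)
no-square-digit1 q square = odd≢even q q (begin
  suc (q + q)                                  ≡⟨ prefix-count-2 (suc (q + q)) 0F ⟨
  count y 2F 0 (3 * suc (q + q))               ≡⟨ cong (count y 2F 0) (regroup q) ⟩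
  count y 2F 0 (suc (m + m))                   ≡⟨ +-identityʳ _ ⟨
  count y 2F 0 (suc (m + m)) + 0               ≡⟨ square-prefix-counts y m square 2F ⟩
  count y 2F 0 (suc m) + count y 2F 0 (suc m)  ≡⟨ cong₂ _+_ (prefix-count-2 q 2F) (prefix-count-2 q 2F) ⟩
  q + q                                        ∎)
  where
  open ≡-Reasoning
  m = 1 + 3 * q
  regroup : ∀ q → 3 * suc (q + q) ≡ suc (suc (3 * q) + suc (3 * q))
  regroup = solve-∀

-- Half-length 2 + 3q: the prefixes of y of lengths 5 + 6q and 3 + 3q contain
-- 2q + 1 and q + 1 letters 2, and 2q + 1 ≠ 2q + 2.
no-square-digit2 : ∀ q → ¬ AbEq (y ∘ suc) 0 (2 + 3 * q) (2 + 3 * q)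
no-square-digit2 q square = odd≢even q (suc q) (begin
  suc (q + q)                                  ≡⟨ prefix-count-2 (suc (q + q)) 2F ⟨
  count y 2F 0 (2 + 3 * suc (q + q))           ≡⟨ cong (count y 2F 0) (regroup q) ⟩
  count y 2F 0 (suc (m + m))                   ≡⟨ +-identityʳ _ ⟨
  count y 2F 0 (suc (m + m)) + 0               ≡⟨ square-prefix-counts y m square 2F ⟩
  count y 2F 0 (suc m) + count y 2F 0 (suc m)  ≡⟨ cong₂ _+_ half half ⟩
  suc q + suc q                                ∎)
  where
  open ≡-Reasoning
  m = 2 + 3 * q
  regroup : ∀ q → 2 + 3 * suc (q + q) ≡ suc (2 + 3 * q + (2 + 3 * q))
  regroup = solve-∀
  half : count y 2F 0 (suc m) ≡ suc q
  half = trans (cong (count y 2F 0) (sym (*-suc 3 q))) (prefix-count-2 (suc q) 0F)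

no-abelian-square-prefix : ¬ HasAbelianSquarePrefix (y ∘ suc)
no-abelian-square-prefix (m , 1≤m , square) with base3? m
... | base3 zero    0F = n≮0 1≤m
... | base3 (suc q) 0F = no-square-digit0 (suc q) (s≤s z≤n) square
... | base3 q       1F = no-square-digit1 q square
... | base3 q       2F = no-square-digit2 q square

mainTheorem3 : ∃[ k ] ∃[ x ] (UniformlyRecurrent {k} x × BoundedAbelianComplexity x × ¬ HasAbelianSquarePrefix x)
mainTheorem3 =
  3 , y ∘ suc ,
  uniformlyRecurrent-drop y (fix-uniformlyRecurrent 4 zero-near) ,
  balanced⇒bounded 3 (y ∘ suc) (balanced-drop 3 y y-balanced) ,
  no-abelian-square-prefix
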